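{- Let $\mathsf{n}$ be a linearly dependent tuple of linear subspaces of a finite-dimensional vector space $V$ over a field $\mathbb{K}$. The rank of the Minkowski matroid $\mathsf{M}(\mathsf{n})$ equals $\dim\langle\mathsf{n}\rangle$ if and only if every basis of $\mathsf{M}(\mathsf{n})$ is a BK-tuple.
   Context: A tuple is a finite indexed family of linear subspaces of $V$ (repetitions allowed); a subtuple is a subfamily indexed by a subset of the index set. For a tuple $\mathsf{k}$, $\langle\mathsf{k}\rangle=\sum_{L\in\mathsf{k}}L$ (zero for the empty tuple), $\mathfrak{c}(\mathsf{k})$ is the number of its entries, and $\delta(\mathsf{k})=\dim\langle\mathsf{k}\rangle-\mathfrak{c}(\mathsf{k})$ is its defect. A tuple is linearly independent if every subtuple (including itself) has non-negative defect, and linearly dependent otherwise. A BK-tuple is a linearly independent tuple with defect $0$. The Minkowski matroid $\mathsf{M}(\mathsf{n})$ has ground set the entries (indices) of $\mathsf{n}$ and independent sets the linearly independent subtuples; its rank is the maximal cardinality of a linearly independent subtuple of $\mathsf{n}$. -}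

module Defs where

open import Level using (Level; _⊔_)
open import Data.Nat using (ℕ; zero; suc; _≤_)
open import Data.Fin using (Fin; zero; suc)
open import Data.Fin.Subset using (Subset; _⊆_; ∣_∣; ⊤; inside; outside)
open import Data.Vec using (_∷_)
open import Data.Product using (Σ; _×_; _,_; ∃)
open import Relation.Nullary using (¬_)
open import Relation.Binary.PropositionalEquality using (_≡_)
open import Algebra.Bundles using (CommutativeRing)

record Field (c ℓ : Level) : Set (Level.suc (c ⊔ ℓ)) where
  field
    commRing : CommutativeRing c ℓ
  open CommutativeRing commRing public
  field
    1≉0     : ¬ (1# ≈ 0#)
    inverse : ∀ x → ¬ (x ≈ 0#) → Σ Carrier λ y → (x * y) ≈ 1#

-- Everything below is relative to a field K and the finite-dimensional
-- vector space V = K^m (every finite-dimensional K-vector space is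
-- isomorphic to some K^m).
module LinAlg {c ℓ : Level} (K : Field c ℓ) (m : ℕ) where
  open Field K using (Carrier; _≈_; _+_; _*_; 0#; 1#)

  V : Set c
  V = Fin m → Carrier

  infix 4 _≈ᵥ_
  _≈ᵥ_ : V → V → Set ℓ
  u ≈ᵥ v = ∀ j → u j ≈ v j

  0ᵥ : V
  0ᵥ _ = 0#

  _+ᵥ_ : V → V → V
  (u +ᵥ v) j = u j + v j

  _·_ : Carrier → V → V
  (a · v) j = a * v j

  Σᵥ : ∀ {k} → (Fin k → V) → V
  Σᵥ {zero}  f = 0ᵥ
  Σᵥ {suc k} f = f zero +ᵥ Σᵥ (λ i → f (suc i))

  Σᵥ[_] : ∀ {k} → Subset k → (Fin k → V) → V
  Σᵥ[_] {zero}  S f = 0ᵥ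
  Σᵥ[_] {suc k} (outside ∷ S) f = Σᵥ[ S ] (λ i → f (suc i))
  Σᵥ[_] {suc k} (inside ∷ S) f = f zero +ᵥ Σᵥ[ S ] (λ i → f (suc i))

  record Subspace : Set (Level.suc (c ⊔ ℓ)) where
    field
      Mem    : V → Set (c ⊔ ℓ)
      resp   : ∀ {u v} → u ≈ᵥ v → Mem u → Mem v
      has0   : Mem 0ᵥ
      close+ : ∀ {u v} → Mem u → Mem v → Mem (u +ᵥ v)
      close· : ∀ a {v} → Mem v → Mem (a · v)
  open Subspace public

  LinIndepVecs : ∀ {k} → (Fin k → V) → Set (c ⊔ ℓ)
  LinIndepVecs {k} v = ∀ (a : Fin k → Carrier) →
    Σᵥ (λ i → a i · v i) ≈ᵥ 0ᵥ → ∀ i → a i ≈ 0#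

  DimGE : (V → Set (c ⊔ ℓ)) → ℕ → Set (c ⊔ ℓ)
  DimGE P k = Σ (Fin k → V) λ v → (∀ i → P (v i)) × LinIndepVecs v

  HasDim : (V → Set (c ⊔ ℓ)) → ℕ → Set (c ⊔ ℓ)
  HasDim P d = DimGE P d × ¬ DimGE P (suc d)

  Tuple : ℕ → Set (Level.suc (c ⊔ ℓ))
  Tuple k = Fin k → Subspace

  ⟨_∣_⟩ : ∀ {k} → Tuple k → Subset k → V → Set (c ⊔ ℓ)
  ⟨_∣_⟩ {k} n S v = Σ (Fin k → V) λ w → (∀ i → Mem (n i) (w i)) × (v ≈ᵥ Σᵥ[ S ] w)

  ⟨_⟩ : ∀ {k} → Tuple k → V → Set (c ⊔ ℓ)
  ⟨ n ⟩ = ⟨ n ∣ ⊤ ⟩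

  -- The subtuple of n indexed by S is linearly independent:
  -- every subtuple T ⊆ S has non-negative defect, i.e. dim ⟨T⟩ ≥ ∣T∣.
  IsLinIndep : ∀ {k} → Tuple k → Subset k → Set (c ⊔ ℓ)
  IsLinIndep n S = ∀ T → T ⊆ S → DimGE ⟨ n ∣ T ⟩ ∣ T ∣

  IsLinDep : ∀ {k} → Tuple k → Set (c ⊔ ℓ)
  IsLinDep n = ¬ IsLinIndep n ⊤

  -- The subtuple indexed by S is a BK-tuple: linearly independent of defect 0
  IsBK : ∀ {k} → Tuple k → Subset k → Set (c ⊔ ℓ)
  IsBK n S = IsLinIndep n S × HasDim ⟨ n ∣ S ⟩ ∣ S ∣

  -- Minkowski matroid M(n): independent sets = linearly independent subtuples.
  -- A basis is an inclusion-maximal independent set.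
  IsBasis : ∀ {k} → Tuple k → Subset k → Set (c ⊔ ℓ)
  IsBasis n B = IsLinIndep n B × (∀ T → B ⊆ T → IsLinIndep n T → T ⊆ B)

  HasRank : ∀ {k} → Tuple k → ℕ → Set (c ⊔ ℓ)
  HasRank {k} n r = (Σ (Subset k) λ S → IsLinIndep n S × ∣ S ∣ ≡ r)
              × (∀ S → IsLinIndep n S → ∣ S ∣ ≤ r)

{-# OPTIONS --safe #-}
module Submission where

-- Write f S = dim ⟨n ∣ S⟩. This f is monotone, f ∅ = 0, and it is submodular: extend a basis of
-- ⟨n ∣ S ∩ T⟩ inside ⟨n ∣ S⟩ and inside ⟨n ∣ T⟩; every vector of ⟨n ∣ S ∪ T⟩ lies in the span of
-- both extensions together, which share the basis of the intersection, so the Steinitz bound gives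
-- f (S ∪ T) + f (S ∩ T) ≤ f S + f T. The linearly independent subtuples are exactly the S with
-- ∣T∣ ≤ f T for all T ⊆ S, so M(n) is the matroid induced by the submodular function f.
--
-- Let B be a basis. For j ∉ B, the dependence of B ∪ {j} produces a tight set T ⊆ B
-- (f T ≤ ∣T∣) spanning j (f (T ∪ {j}) ≤ f T). By submodularity unions of tight subsets of B are
-- tight and spanning is inherited by supersets, so a single tight U ⊆ B spans the whole complement
-- of B. Counting with U gives ∣S∣ ≤ ∣B∣ for every independent S, hence ∣B∣ = r, and
-- f ⊤ ≤ f B, hence dim ⟨n ∣ B⟩ = d. So a basis is a BK-tuple, dim ⟨n ∣ B⟩ = ∣B∣, exactly when
-- d = r.
--
-- Equality in K is not decidable, so dimensions (and the outcome of Gaussian elimination) exist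
-- only under double negation; this is enough because they are only used to prove negated or
-- decidable statements.

open import Defs
open import Level using (Level; _⊔_)
open import Data.Nat as ℕ using (ℕ; zero; suc; _≤_; _<_; z≤n; s≤s; s≤s⁻¹; _≤?_; _<?_)
open import Data.Nat.Properties
  using (≤-refl; ≤-trans; ≤-reflexive; ≤-antisym; <-≤-trans; n≮0; 1+n≰n; <⇒≱; ≮⇒≥; ≰⇒>;
         m≤n⇒m≤1+n; m≤n⇒m<n∨m≡n; n≤0⇒n≡0)
open import Data.Fin using (Fin; zero; suc)
open import Data.Fin.Subset
  using (Subset; inside; outside; _∈_; _∉_; _⊆_; _∪_; _∩_; _─_; _-_; ∁; ⁅_⁆; ⊥; ⊤; ∣_∣; Empty)
open import Data.Fin.Subset.Properties
  using (_∈?_; _⊆?_; anySubset?; ⊥⊆; ⊆⊤; ⊆-refl; ⊆-reflexive; p⊆q⇒∣p∣≤∣q∣; p⊂q⇒∣p∣<∣q∣; p∩q⊆p; p∩q⊆q;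
         p⊆p∪q; q⊆p∪q; p─q⊆p; x∈⁅x⁆; x∈⁅y⁆⇒x≡y; x∈p∪q⁻; x∈p∧x∉q⇒x∈p─q; x∈p∧x≢y⇒x∈p-y; x∈∁p⇒x∉p;
         x∉∁p⇒x∈p; p∪∁p≡⊤)
open import Data.Product using (Σ; ∃; _×_; _,_; proj₁; proj₂)
open import Data.Sum using (_⊎_; inj₁; inj₂; [_,_]′)
open import Function using (id; _∘_; const)
open import Function.Bundles using (_⇔_; mk⇔; module Equivalence)
open Equivalence using (to; from)
open import Relation.Nullary using (¬_; yes; no)
open import Relation.Nullary.Decidable using (decidable-stable; ¬¬-excluded-middle; _×-dec_)
open import Relation.Nullary.Negation using (DoubleNegation; ¬¬-map; negated-stable; contradiction)
import Relation.Binary.PropositionalEquality as ≡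
open ≡ using (_≡_; _≗_)

private
  variable
    ℓ₁ ℓ₂ : Level
    A : Set ℓ₁
    B : Set ℓ₂

infixl 1 _>>=_

_>>=_ : DoubleNegation A → (A → DoubleNegation B) → DoubleNegation B
m >>= f = negated-stable (¬¬-map f m)

pure : A → DoubleNegation A
pure = contradiction

¬¬-∀-Fin : ∀ {k} {Q : Fin k → Set ℓ₁} → (∀ i → DoubleNegation (Q i)) → DoubleNegation (∀ i → Q i)
¬¬-∀-Fin {k = zero}  h = pure λ ()
¬¬-∀-Fin {k = suc k} h = h zero >>= λ q₀ → ¬¬-∀-Fin (h ∘ suc) >>= λ qₛ →
  pure λ { zero → q₀ ; (suc i) → qₛ i }

¬¬-∀-or-∃¬ : ∀ {k} (Q : Fin k → Set ℓ₁) → DoubleNegation ((∀ i → Q i) ⊎ ∃ λ i → ¬ Q i)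
¬¬-∀-or-∃¬ Q = ¬¬-excluded-middle >>= λ
  { (yes counterexample) → pure (inj₂ counterexample)
  ; (no none)            → ¬¬-map inj₁ (¬¬-∀-Fin λ i ¬Qi → none (i , ¬Qi)) }

module Coordinates {c ℓ} (K : Field c ℓ) where

  open import Data.Fin using (punchIn; punchOut; _↑ˡ_; _↑ʳ_; splitAt)
  open import Data.Fin.Properties using (punchIn-punchOut) renaming (_≟_ to _≟ᶠ_)
  open import Data.Nat.Properties using (+-mono-≤; +-monoˡ-≤)
  import Data.Nat.Properties as ℕₚ
  open import Data.Vec.Functional using (Vector; _∷_; _++_; tail; insertAt)
  open import Data.Vec.Functional.Relation.Unary.All using (All)
  open import Data.Vec.Functional.Relation.Unary.All.Properties using (++⁺)
  open import Data.Vec.Functional.Properties using (lookup-++ˡ; lookup-++ʳ; insertAt-lookup; insertAt-punchIn)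

  open Field K hiding (zero)
  open import Algebra.Properties.CommutativeMonoid.Sum +-commutativeMonoid
    using (sum; sum-remove; ∑-distrib-+; ∑-comm; sum-cong-≋; sum-replicate-zero)
  open import Algebra.Properties.Semiring.Sum semiring using (*-distribˡ-sum; *-distribʳ-sum)
  open import Algebra.Properties.Ring ring using (-‿distribˡ-*; -‿distribʳ-*; +-cancelˡ; +-inverseˡ-unique)
  open import Algebra.Solver.CommutativeMonoid +-commutativeMonoid using (solve; _⊕_; _⊜_)
  open import Relation.Binary.Reasoning.Setoid setoid

  ∷-++ : ∀ {s g} {A : Set ℓ₁} (y : A) (x : Vector A s) (u : Vector A g) → (y ∷ x) ++ u ≗ y ∷ (x ++ u)
  ∷-++         y x u zero    = ≡.refl
  ∷-++ {s = s} y x u (suc i) with splitAt s i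
  ... | inj₁ _ = ≡.refl
  ... | inj₂ _ = ≡.refl

  *-cancelʳ-≉0 : ∀ {x y z} → ¬ y ≈ 0# → x * y ≈ z * y → x ≈ z
  *-cancelʳ-≉0 {x} {y} {z} y≉0 xy≈zy = begin
    x             ≈⟨ y-invertible x ⟨
    x * y * y⁻¹   ≈⟨ *-congʳ xy≈zy ⟩
    z * y * y⁻¹   ≈⟨ y-invertible z ⟩
    z             ∎
    where
    y⁻¹ = proj₁ (inverse y y≉0)
    y-invertible : ∀ w → w * y * y⁻¹ ≈ w
    y-invertible w = trans (*-assoc w y y⁻¹) (trans (*-congˡ (proj₂ (inverse y y≉0))) (*-identityʳ w))

  sum-≈0 : ∀ {k} (f : Fin k → Carrier) → (∀ i → f i ≈ 0#) → sum f ≈ 0#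
  sum-≈0 {k} f f≈0 = trans (sum-cong-≋ f≈0) (sum-replicate-zero k)

  sum-↑ : ∀ s {g} (f : Fin (s ℕ.+ g) → Carrier) → sum f ≈ sum (f ∘ (_↑ˡ g)) + sum (f ∘ (s ↑ʳ_))
  sum-↑ zero    f = sym (+-identityˡ _)
  sum-↑ (suc s) f = trans (+-congˡ (sum-↑ s (f ∘ suc))) (sym (+-assoc _ _ _))

  lincomb : ∀ {k m} → Vector Carrier k → Vector (Vector Carrier m) k → Vector Carrier m
  lincomb a v j = sum λ i → a i * v i j

  Independent : ∀ {k m} → Vector (Vector Carrier m) k → Set (c ⊔ ℓ)
  Independent v = ∀ a → (∀ j → lincomb a v j ≈ 0#) → ∀ i → a i ≈ 0#

  Dependent : ∀ {k m} → Vector (Vector Carrier m) k → Set (c ⊔ ℓ)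
  Dependent v = Σ _ λ a → (∀ j → lincomb a v j ≈ 0#) × ∃ λ i → ¬ a i ≈ 0#

  Dependent⇒¬Independent : ∀ {k m} {v : Vector (Vector Carrier m) k} → Dependent v → ¬ Independent v
  Dependent⇒¬Independent (a , a·v≈0 , i , aᵢ≉0) independent = aᵢ≉0 (independent a a·v≈0 i)

  InSpan : ∀ {g m} → Vector (Vector Carrier m) g → Vector Carrier m → Set (c ⊔ ℓ)
  InSpan u x = Σ _ λ a → ∀ j → x j ≈ lincomb a u j

  lincomb-cong : ∀ {k m} {a b : Vector Carrier k} {v w : Vector (Vector Carrier m) k} →
    (∀ i → a i ≈ b i) → (∀ i j → v i j ≈ w i j) → ∀ j → lincomb a v j ≈ lincomb b w j
  lincomb-cong a≈b v≈w j = sum-cong-≋ λ i → *-cong (a≈b i) (v≈w i j)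

  lincomb-≗ : ∀ {k m} {v w : Vector (Vector Carrier m) k} → v ≗ w → ∀ a j → lincomb a v j ≈ lincomb a w j
  lincomb-≗ v≗w a = lincomb-cong (λ _ → refl) (λ i j → reflexive (≡.cong (λ x → x j) (v≗w i)))

  Independent-≗ : ∀ {k m} {v w : Vector (Vector Carrier m) k} → v ≗ w → Independent v → Independent w
  Independent-≗ v≗w independent a a·w≈0 = independent a λ j → trans (lincomb-≗ v≗w a j) (a·w≈0 j)

  *-lincomb : ∀ {k m} x (a : Vector Carrier k) (v : Vector (Vector Carrier m) k) j →
    x * lincomb a v j ≈ lincomb (λ i → x * a i) v j
  *-lincomb x a v j = trans (*-distribˡ-sum x (λ i → a i * v i j)) (sum-cong-≋ λ i → sym (*-assoc x (a i) (v i j)))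

  lincomb-+ : ∀ {k m} (a b : Vector Carrier k) (v : Vector (Vector Carrier m) k) j →
    lincomb (λ i → a i + b i) v j ≈ lincomb a v j + lincomb b v j
  lincomb-+ a b v j = trans (sum-cong-≋ λ i → distribʳ (v i j) (a i) (b i))
                            (∑-distrib-+ (λ i → a i * v i j) (λ i → b i * v i j))

  lincomb-↑ : ∀ {s g m} (a : Vector Carrier (s ℕ.+ g)) x (u : Vector (Vector Carrier m) g) j →
    lincomb a (x ++ u) j ≈ lincomb (a ∘ (_↑ˡ g)) x j + lincomb (a ∘ (s ↑ʳ_)) u j
  lincomb-↑ {s} {g} a x u j = trans (sum-↑ s (λ i → a i * (x ++ u) i j)) (+-cong
    (sum-cong-≋ λ i → *-congˡ (reflexive (≡.cong (λ y → y j) (lookup-++ˡ x u i))))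
    (sum-cong-≋ λ i → *-congˡ (reflexive (≡.cong (λ y → y j) (lookup-++ʳ x u i)))))

  lincomb-++ : ∀ {s g m} (a : Vector Carrier s) (b : Vector Carrier g) x (u : Vector (Vector Carrier m) g) j →
    lincomb (a ++ b) (x ++ u) j ≈ lincomb a x j + lincomb b u j
  lincomb-++ a b x u j = trans (lincomb-↑ (a ++ b) x u j)
    (+-cong (lincomb-cong {v = x} (reflexive ∘ lookup-++ˡ a b) (λ _ _ → refl) j)
            (lincomb-cong {v = u} (reflexive ∘ lookup-++ʳ a b) (λ _ _ → refl) j))

  lincomb-lincomb : ∀ {e N m} (b : Vector Carrier e) (w : Vector (Vector Carrier m) e)
    (coeff : Vector (Vector Carrier N) e) (y : Vector (Vector Carrier m) N) →
    (∀ i j → w i j ≈ lincomb (coeff i) y j) → ∀ j → lincomb b w j ≈ lincomb (lincomb b coeff) y j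
  lincomb-lincomb b w coeff y w≈ j = begin
    sum (λ i → b i * w i j)
      ≈⟨ sum-cong-≋ (λ i → *-congˡ (w≈ i j)) ⟩
    sum (λ i → b i * sum (λ l → coeff i l * y l j))
      ≈⟨ sum-cong-≋ (λ i → *-lincomb (b i) (coeff i) y j) ⟩
    sum (λ i → sum (λ l → b i * coeff i l * y l j))
      ≈⟨ ∑-comm (λ i l → b i * coeff i l * y l j) ⟩
    sum (λ l → sum (λ i → b i * coeff i l * y l j))
      ≈⟨ sum-cong-≋ (λ l → *-distribʳ-sum (y l j) (λ i → b i * coeff i l)) ⟨
    sum (λ l → sum (λ i → b i * coeff i l) * y l j)
      ∎

  lincomb-tail : ∀ {g m} {a : Vector Carrier (suc g)} (v : Vector (Vector Carrier m) (suc g)) →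
    a zero ≈ 0# → ∀ j → lincomb a v j ≈ lincomb (tail a) (tail v) j
  lincomb-tail v a₀≈0 j = trans (+-congʳ (trans (*-congʳ a₀≈0) (zeroˡ _))) (+-identityˡ _)

  Independent-tail : ∀ {k m} {v : Vector (Vector Carrier m) (suc k)} → Independent v → Independent (tail v)
  Independent-tail {v = v} independent a a·v≈0 i =
    independent (0# ∷ a) (λ j → trans (lincomb-tail {a = 0# ∷ a} v refl j) (a·v≈0 j)) (suc i)

  Independent-columns : ∀ {k m} {v : Vector (Vector Carrier (suc m)) k} → Independent (tail ∘ v) → Independent v
  Independent-columns independent a a·v≈0 = independent a (a·v≈0 ∘ suc)

  Dependent-columns : ∀ {k m} {v : Vector (Vector Carrier (suc m)) k} →
    (∀ i → v i zero ≈ 0#) → Dependent (tail ∘ v) → Dependent v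
  Dependent-columns v≈0 (a , a·v≈0 , i , aᵢ≉0) =
    a , (λ { zero → sum-≈0 _ (λ i → trans (*-congˡ (v≈0 i)) (zeroʳ (a i))) ; (suc j) → a·v≈0 j }) , i , aᵢ≉0

  module Pivot {k m} (v : Vector (Vector Carrier (suc m)) (suc k)) (p : Fin (suc k)) (vₚ₀≉0 : ¬ v p zero ≈ 0#)
    where

    private
      vₚ₀⁻¹ = proj₁ (inverse (v p zero) vₚ₀≉0)
      vₚ₀*vₚ₀⁻¹≈1 = proj₂ (inverse (v p zero) vₚ₀≉0)

    multiplier : Vector Carrier k
    multiplier i = - (v (punchIn p i) zero * vₚ₀⁻¹)

    eliminated : Vector (Vector Carrier (suc m)) k
    eliminated i j = v (punchIn p i) j + multiplier i * v p j

    reduced : Vector (Vector Carrier m) k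
    reduced = tail ∘ eliminated

    eliminated-head≈0 : ∀ i → eliminated i zero ≈ 0#
    eliminated-head≈0 i = begin
      x + - (x * vₚ₀⁻¹) * v p zero    ≈⟨ +-congˡ (-‿distribˡ-* (x * vₚ₀⁻¹) (v p zero)) ⟨
      x + - (x * vₚ₀⁻¹ * v p zero)    ≈⟨ +-congˡ (-‿cong (trans (*-assoc x vₚ₀⁻¹ (v p zero))
                                                                (*-congˡ (*-comm vₚ₀⁻¹ (v p zero))))) ⟩
      x + - (x * (v p zero * vₚ₀⁻¹))  ≈⟨ +-congˡ (-‿cong (trans (*-congˡ vₚ₀*vₚ₀⁻¹≈1) (*-identityʳ x))) ⟩
      x + - x                         ≈⟨ -‿inverseʳ x ⟩
      0#                              ∎
      where x = v (punchIn p i) zero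

    lincomb-eliminated-head : ∀ b → lincomb b eliminated zero ≈ 0#
    lincomb-eliminated-head b = sum-≈0 _ λ i → trans (*-congˡ (eliminated-head≈0 i)) (zeroʳ (b i))

    shift : Vector Carrier k → Carrier
    shift b = sum λ i → b i * multiplier i

    lincomb-eliminated : ∀ b j → lincomb b eliminated j ≈ lincomb b (v ∘ punchIn p) j + shift b * v p j
    lincomb-eliminated b j = begin
      sum (λ i → b i * (v (punchIn p i) j + multiplier i * v p j))
        ≈⟨ sum-cong-≋ (λ i → trans (distribˡ (b i) _ _) (+-congˡ (sym (*-assoc (b i) (multiplier i) (v p j))))) ⟩
      sum (λ i → b i * v (punchIn p i) j + b i * multiplier i * v p j)
        ≈⟨ ∑-distrib-+ (λ i → b i * v (punchIn p i) j) (λ i → b i * multiplier i * v p j) ⟩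
      lincomb b (v ∘ punchIn p) j + sum (λ i → b i * multiplier i * v p j)
        ≈⟨ +-congˡ (*-distribʳ-sum (v p j) (λ i → b i * multiplier i)) ⟨
      lincomb b (v ∘ punchIn p) j + shift b * v p j
        ∎

    lincomb-removeAt : ∀ a j → lincomb a v j ≈ a p * v p j + lincomb (a ∘ punchIn p) (v ∘ punchIn p) j
    lincomb-removeAt a j = sum-remove {i = p} (λ i → a i * v i j)

    Dependent-lift : Dependent reduced → Dependent v
    Dependent-lift (b , b·r≈0 , i , bᵢ≉0) =
      a , a·v≈0 , punchIn p i , λ aᵢ≈0 → bᵢ≉0 (trans (reflexive (≡.sym (insertAt-punchIn b p (shift b) i))) aᵢ≈0)
      where
      a = insertAt b p (shift b)
      b·e≈0 : ∀ j → lincomb b eliminated j ≈ 0#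
      b·e≈0 zero    = lincomb-eliminated-head b
      b·e≈0 (suc j) = b·r≈0 j
      a·v≈0 : ∀ j → lincomb a v j ≈ 0#
      a·v≈0 j = begin
        lincomb a v j
          ≈⟨ lincomb-removeAt a j ⟩
        a p * v p j + lincomb (a ∘ punchIn p) (v ∘ punchIn p) j
          ≈⟨ +-cong (*-congʳ (reflexive (insertAt-lookup b p (shift b))))
                    (lincomb-cong {v = v ∘ punchIn p} (reflexive ∘ insertAt-punchIn b p (shift b))
                                  (λ _ _ → refl) j) ⟩
        shift b * v p j + lincomb b (v ∘ punchIn p) j
          ≈⟨ trans (+-comm _ _) (sym (lincomb-eliminated b j)) ⟩
        lincomb b eliminated j
          ≈⟨ b·e≈0 j ⟩
        0# ∎

    Independent-lift : Independent reduced → Independent v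
    Independent-lift independent a a·v≈0 = a≈0
      where
      b = a ∘ punchIn p
      a·v+shift : ∀ j → lincomb a v j + shift b * v p j ≈ a p * v p j + lincomb b eliminated j
      a·v+shift j = begin
        lincomb a v j + shift b * v p j
          ≈⟨ +-congʳ (lincomb-removeAt a j) ⟩
        a p * v p j + lincomb b (v ∘ punchIn p) j + shift b * v p j
          ≈⟨ +-assoc _ _ _ ⟩
        a p * v p j + (lincomb b (v ∘ punchIn p) j + shift b * v p j)
          ≈⟨ +-congˡ (lincomb-eliminated b j) ⟨
        a p * v p j + lincomb b eliminated j
          ∎
      shift≈aₚ : shift b ≈ a p
      shift≈aₚ = *-cancelʳ-≉0 vₚ₀≉0 (begin
        shift b * v p zero                          ≈⟨ +-identityˡ _ ⟨
        0# + shift b * v p zero                     ≈⟨ +-congʳ (a·v≈0 zero) ⟨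
        lincomb a v zero + shift b * v p zero       ≈⟨ a·v+shift zero ⟩
        a p * v p zero + lincomb b eliminated zero  ≈⟨ +-congˡ (lincomb-eliminated-head b) ⟩
        a p * v p zero + 0#                         ≈⟨ +-identityʳ _ ⟩
        a p * v p zero                              ∎)
      b·r≈0 : ∀ j → lincomb b reduced j ≈ 0#
      b·r≈0 j = +-cancelˡ (a p * v p (suc j)) _ _ (begin
        a p * v p (suc j) + lincomb b reduced j  ≈⟨ a·v+shift (suc j) ⟨
        lincomb a v (suc j) + shift b * v p (suc j)  ≈⟨ +-cong (a·v≈0 (suc j)) (*-congʳ shift≈aₚ) ⟩
        0# + a p * v p (suc j)                       ≈⟨ +-comm _ _ ⟩
        a p * v p (suc j) + 0#                       ∎)
      b≈0 : ∀ i → b i ≈ 0#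
      b≈0 = independent b b·r≈0
      a≈0 : ∀ x → a x ≈ 0#
      a≈0 x with p ≟ᶠ x
      ... | yes ≡.refl = trans (sym shift≈aₚ) (sum-≈0 _ λ i → trans (*-congʳ (b≈0 i)) (zeroˡ _))
      ... | no p≢x     = trans (reflexive (≡.cong a (≡.sym (punchIn-punchOut p≢x)))) (b≈0 (punchOut p≢x))

  gaussian-elimination : ∀ {k} m (v : Vector (Vector Carrier m) k) →
    DoubleNegation (Dependent v ⊎ (k ≤ m × Independent v))
  gaussian-elimination {zero}  zero    v = pure (inj₂ (z≤n , λ _ _ ()))
  gaussian-elimination {suc k} zero    v = pure (inj₁ (const 1# , (λ ()) , zero , 1≉0))
  gaussian-elimination         (suc m) v = ¬¬-∀-or-∃¬ (λ i → v i zero ≈ 0#) >>= λ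
    { (inj₁ v≈0)          → ¬¬-map (zero-column v≈0) (gaussian-elimination m (tail ∘ v))
    ; (inj₂ (p , vₚ₀≉0)) → pivot-column v p vₚ₀≉0 }
    where
    zero-column : ∀ {k} {v : Vector (Vector Carrier (suc m)) k} → (∀ i → v i zero ≈ 0#) →
      Dependent (tail ∘ v) ⊎ (k ≤ m × Independent (tail ∘ v)) → Dependent v ⊎ (k ≤ suc m × Independent v)
    zero-column v≈0 (inj₁ dependent)        = inj₁ (Dependent-columns v≈0 dependent)
    zero-column v≈0 (inj₂ (k≤m , independent)) = inj₂ (m≤n⇒m≤1+n k≤m , Independent-columns independent)
    pivot-column : ∀ {k} (v : Vector (Vector Carrier (suc m)) k) p → ¬ v p zero ≈ 0# →
      DoubleNegation (Dependent v ⊎ (k ≤ suc m × Independent v))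
    pivot-column {suc k} v p vₚ₀≉0 = ¬¬-map lift (gaussian-elimination m reduced)
      where
      open Pivot v p vₚ₀≉0
      lift : Dependent reduced ⊎ (k ≤ m × Independent reduced) → Dependent v ⊎ (suc k ≤ suc m × Independent v)
      lift (inj₁ dependent)            = inj₁ (Dependent-lift dependent)
      lift (inj₂ (k≤m , independent)) = inj₂ (s≤s k≤m , Independent-lift independent)

  independent⇒≤ : ∀ {k m} {v : Vector (Vector Carrier m) k} → Independent v → k ≤ m
  independent⇒≤ {k} {m} {v} independent = decidable-stable (k ≤? m) (gaussian-elimination m v >>= λ
    { (inj₁ dependent)  → contradiction independent (Dependent⇒¬Independent dependent)
    ; (inj₂ (k≤m , _)) → pure k≤m })

  InSpan-resp : ∀ {g m} {u : Vector (Vector Carrier m) g} {x y} → (∀ j → x j ≈ y j) → InSpan u y → InSpan u x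
  InSpan-resp x≈y (a , y≈a·u) = a , λ j → trans (x≈y j) (y≈a·u j)

  InSpan-≗ : ∀ {g m} {u w : Vector (Vector Carrier m) g} {x} → u ≗ w → InSpan u x → InSpan w x
  InSpan-≗ u≗w (a , x≈a·u) = a , λ j → trans (x≈a·u j) (lincomb-≗ u≗w a j)

  InSpan-∷ : ∀ {g m} {u : Vector (Vector Carrier m) g} {x} y → InSpan u x → InSpan (y ∷ u) x
  InSpan-∷ {u = u} y (a , x≈a·u) =
    (0# ∷ a) , λ j → trans (x≈a·u j) (sym (lincomb-tail {a = 0# ∷ a} (y ∷ u) refl j))

  InSpan-head : ∀ {g m} (y : Vector Carrier m) (u : Vector (Vector Carrier m) g) → InSpan (y ∷ u) y
  InSpan-head y u = (1# ∷ const 0#) , λ j → sym (begin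
    1# * y j + lincomb (const 0#) u j  ≈⟨ +-cong (*-identityˡ (y j)) (sum-≈0 _ λ i → zeroˡ (u i j)) ⟩
    y j + 0#                           ≈⟨ +-identityʳ (y j) ⟩
    y j                                ∎)

  InSpan-+ : ∀ {s t g m} {x : Vector (Vector Carrier m) s} {z : Vector (Vector Carrier m) t}
    {u : Vector (Vector Carrier m) g} {y y′} →
    InSpan (x ++ u) y → InSpan (z ++ u) y′ → InSpan (x ++ (z ++ u)) (λ j → y j + y′ j)
  InSpan-+ {s} {t} {g} {x = x} {z} {u} {y} {y′} (a , y≈a·xu) (b , y′≈b·zu) = coefficients , λ j → begin
    y j + y′ j
      ≈⟨ +-cong (trans (y≈a·xu j) (lincomb-↑ a x u j)) (trans (y′≈b·zu j) (lincomb-↑ b z u j)) ⟩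
    (lincomb aˣ x j + lincomb aᵘ u j) + (lincomb bᶻ z j + lincomb bᵘ u j)
      ≈⟨ regroup _ _ _ _ ⟩
    lincomb aˣ x j + (lincomb bᶻ z j + (lincomb aᵘ u j + lincomb bᵘ u j))
      ≈⟨ +-congˡ (+-congˡ (lincomb-+ aᵘ bᵘ u j)) ⟨
    lincomb aˣ x j + (lincomb bᶻ z j + lincomb (λ l → aᵘ l + bᵘ l) u j)
      ≈⟨ +-congˡ (lincomb-++ bᶻ _ z u j) ⟨
    lincomb aˣ x j + lincomb (bᶻ ++ λ l → aᵘ l + bᵘ l) (z ++ u) j
      ≈⟨ lincomb-++ aˣ _ x (z ++ u) j ⟨
    lincomb coefficients (x ++ (z ++ u)) j
      ∎
    where
    aˣ = a ∘ (_↑ˡ g)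
    aᵘ = a ∘ (s ↑ʳ_)
    bᶻ = b ∘ (_↑ˡ g)
    bᵘ = b ∘ (t ↑ʳ_)
    coefficients = aˣ ++ (bᶻ ++ λ l → aᵘ l + bᵘ l)
    regroup : ∀ p q r w → (p + q) + (r + w) ≈ p + (r + (q + w))
    regroup = solve 4 (λ p q r w → (p ⊕ q) ⊕ (r ⊕ w) ⊜ p ⊕ (r ⊕ (q ⊕ w))) refl

  Independent-∷-or-InSpan : ∀ {g m} {u : Vector (Vector Carrier m) g} → Independent u →
    ∀ x → DoubleNegation (Independent (x ∷ u) ⊎ InSpan u x)
  Independent-∷-or-InSpan {g} {m} {u} independent x = gaussian-elimination m (x ∷ u) >>= λ
    { (inj₂ (_ , independent-∷)) → pure (inj₁ independent-∷)
    ; (inj₁ (a , a·xu≈0 , i , aᵢ≉0)) → ¬¬-excluded-middle >>= λ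
      { (yes a₀≈0) → contradiction (all-zero a a·xu≈0 a₀≈0 i) aᵢ≉0
      ; (no a₀≉0)  → pure (inj₂ (solve-for-head a a·xu≈0 a₀≉0)) } }
    where
    all-zero : ∀ a → (∀ j → lincomb a (x ∷ u) j ≈ 0#) → a zero ≈ 0# → ∀ i → a i ≈ 0#
    all-zero a a·xu≈0 a₀≈0 zero    = a₀≈0
    all-zero a a·xu≈0 a₀≈0 (suc i) =
      independent (tail a) (λ j → trans (sym (lincomb-tail {a = a} (x ∷ u) a₀≈0 j)) (a·xu≈0 j)) i
    solve-for-head : ∀ a → (∀ j → lincomb a (x ∷ u) j ≈ 0#) → ¬ a zero ≈ 0# → InSpan u x
    solve-for-head a a·xu≈0 a₀≉0 = (λ i → - a₀⁻¹ * a (suc i)) , x≈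
      where
      a₀⁻¹ = proj₁ (inverse (a zero) a₀≉0)
      x≈ : ∀ j → x j ≈ lincomb (λ i → - a₀⁻¹ * a (suc i)) u j
      x≈ j = begin
        x j                     ≈⟨ *-identityˡ (x j) ⟨
        1# * x j                ≈⟨ *-congʳ (trans (*-comm a₀⁻¹ (a zero)) (proj₂ (inverse (a zero) a₀≉0))) ⟨
        a₀⁻¹ * a zero * x j     ≈⟨ *-assoc a₀⁻¹ (a zero) (x j) ⟩
        a₀⁻¹ * (a zero * x j)   ≈⟨ *-congˡ (+-inverseˡ-unique _ _ (a·xu≈0 j)) ⟩
        a₀⁻¹ * - L              ≈⟨ -‿distribʳ-* a₀⁻¹ L ⟨
        - (a₀⁻¹ * L)            ≈⟨ -‿distribˡ-* a₀⁻¹ L ⟩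
        - a₀⁻¹ * L              ≈⟨ *-lincomb (- a₀⁻¹) (tail a) u j ⟩
        lincomb (λ i → - a₀⁻¹ * a (suc i)) u j ∎
        where L = lincomb (tail a) u j

  record Extension {p g m e} (P : Vector Carrier m → Set p) (u : Vector (Vector Carrier m) g)
                   (q : Vector (Vector Carrier m) e) : Set (c ⊔ ℓ ⊔ p) where
    field
      size        : ℕ
      added       : Vector (Vector Carrier m) size
      added∈P     : All P added
      independent : Independent (added ++ u)
      spans       : ∀ l → InSpan (added ++ u) (q l)

  extend-to-span : ∀ {p g m e} (P : Vector Carrier m → Set p) {u : Vector (Vector Carrier m) g} →
    Independent u → (q : Vector (Vector Carrier m) e) → All P q → DoubleNegation (Extension P u q)
  extend-to-span {e = zero} P u-independent q q∈P =
    pure record { size = 0 ; added = λ () ; added∈P = λ () ; independent = u-independent ; spans = λ () }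
  extend-to-span {e = suc e} P {u} u-independent q q∈P =
    extend-to-span P u-independent (tail q) (q∈P ∘ suc) >>= λ E →
    ¬¬-map (step E) (Independent-∷-or-InSpan (Extension.independent E) (q zero))
    where
    step : (E : Extension P u (tail q)) → let xu = Extension.added E ++ u in
      Independent (q zero ∷ xu) ⊎ InSpan xu (q zero) → Extension P u q
    step E (inj₂ q₀∈span) = record
      { size = size ; added = added ; added∈P = added∈P ; independent = independent
      ; spans = λ { zero → q₀∈span ; (suc l) → spans l } }
      where open Extension E
    step E (inj₁ independent-∷) = record
      { size        = suc size
      ; added       = q zero ∷ added
      ; added∈P     = λ { zero → q∈P zero ; (suc i) → added∈P i }
      ; independent = Independent-≗ (≡.sym ∘ ∷-++ (q zero) added u) independent-∷
      ; spans       = λ l → InSpan-≗ (≡.sym ∘ ∷-++ (q zero) added u) (spans′ l)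
      }
      where
      open Extension E
      spans′ : ∀ l → InSpan (q zero ∷ (added ++ u)) (q l)
      spans′ zero    = InSpan-head (q zero) (added ++ u)
      spans′ (suc l) = InSpan-∷ (q zero) (spans l)

  independent-in-span⇒≤ : ∀ {e N m} {w : Vector (Vector Carrier m) e} {y : Vector (Vector Carrier m) N} →
    Independent w → (∀ i → InSpan y (w i)) → e ≤ N
  independent-in-span⇒≤ {w = w} {y} independent w∈span = independent⇒≤ coefficients-independent
    where
    coefficients = proj₁ ∘ w∈span
    coefficients-independent : Independent coefficients
    coefficients-independent b b·coefficients≈0 = independent b λ j → begin
      lincomb b w j                          ≈⟨ lincomb-lincomb b w coefficients y (proj₂ ∘ w∈span) j ⟩
      lincomb (lincomb b coefficients) y j   ≈⟨ sum-≈0 _ (λ l → trans (*-congʳ (b·coefficients≈0 l)) (zeroˡ _)) ⟩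
      0#                                     ∎

  DimAtLeast : ∀ {p m} → (Vector Carrier m → Set p) → ℕ → Set (c ⊔ ℓ ⊔ p)
  DimAtLeast {m = m} P k = Σ (Vector (Vector Carrier m) k) λ v → All P v × Independent v

  DimAtLeast-≤ : ∀ {p m} {P : Vector Carrier m → Set p} {k n} → n ≤ k → DimAtLeast P k → DimAtLeast P n
  DimAtLeast-≤ {k = k} n≤k dim with m≤n⇒m<n∨m≡n n≤k
  ... | inj₂ ≡.refl = dim
  DimAtLeast-≤ {P = P} {k = suc k} n≤k (v , v∈P , independent) | inj₁ (s≤s n≤k′) =
    DimAtLeast-≤ {P = P} n≤k′ (tail v , v∈P ∘ suc , Independent-tail {v = v} independent)

  dim-bound : ∀ {p m} {P : Vector Carrier m → Set p} {d k} → ¬ DimAtLeast P (suc d) → DimAtLeast P k → k ≤ d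
  dim-bound {P = P} {d} {k} ¬dim dim =
    decidable-stable (k ≤? d) λ k≰d → ¬dim (DimAtLeast-≤ {P = P} (≰⇒> k≰d) dim)

  dim-submodular : ∀ {p m} {P Q R W : Vector Carrier m → Set p} →
    (∀ {v} → R v → P v × Q v) →
    (∀ {v} → W v → Σ _ λ x → Σ _ λ z → P x × Q z × ∀ j → v j ≈ x j + z j) →
    ∀ {a b e g} → ¬ DimAtLeast P (suc a) → ¬ DimAtLeast Q (suc b) →
    DimAtLeast W e → DimAtLeast R g → e ℕ.+ g ≤ a ℕ.+ b
  dim-submodular {P = P} {Q} R⊆P∩Q W⊆P+Q {a} {b} {e} {g} ¬dimP ¬dimQ
                 (w , w∈W , w-independent) (u , u∈R , u-independent) =
    decidable-stable (e ℕ.+ g ≤? a ℕ.+ b) (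
      extend-to-span P u-independent wᴾ wᴾ∈P >>= λ X →
      extend-to-span Q u-independent wᵠ wᵠ∈Q >>= λ Z →
      pure (count X Z))
    where
    wᴾ wᵠ : Vector (Vector Carrier _) e
    wᴾ i = proj₁ (W⊆P+Q (w∈W i))
    wᵠ i = proj₁ (proj₂ (W⊆P+Q (w∈W i)))
    wᴾ∈P : All P wᴾ
    wᴾ∈P i = proj₁ (proj₂ (proj₂ (W⊆P+Q (w∈W i))))
    wᵠ∈Q : All Q wᵠ
    wᵠ∈Q i = proj₁ (proj₂ (proj₂ (proj₂ (W⊆P+Q (w∈W i)))))
    w≈wᴾ+wᵠ : ∀ i j → w i j ≈ wᴾ i j + wᵠ i j
    w≈wᴾ+wᵠ i = proj₂ (proj₂ (proj₂ (proj₂ (W⊆P+Q (w∈W i)))))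
    count : Extension P u wᴾ → Extension Q u wᵠ → e ℕ.+ g ≤ a ℕ.+ b
    count X Z = ≤-trans (+-monoˡ-≤ g e≤s+t+g) (≤-trans (≤-reflexive rearrange) (+-mono-≤ s+g≤a t+g≤b))
      where
      module X = Extension X
      module Z = Extension Z
      s = X.size
      t = Z.size
      s+g≤a : s ℕ.+ g ≤ a
      s+g≤a = dim-bound {P = P} ¬dimP (X.added ++ u , ++⁺ P X.added∈P (proj₁ ∘ R⊆P∩Q ∘ u∈R) , X.independent)
      t+g≤b : t ℕ.+ g ≤ b
      t+g≤b = dim-bound {P = Q} ¬dimQ (Z.added ++ u , ++⁺ Q Z.added∈P (proj₂ ∘ R⊆P∩Q ∘ u∈R) , Z.independent)
      e≤s+t+g : e ≤ s ℕ.+ (t ℕ.+ g)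
      e≤s+t+g = independent-in-span⇒≤ {y = X.added ++ (Z.added ++ u)} w-independent λ i →
        InSpan-resp (w≈wᴾ+wᵠ i) (InSpan-+ {x = X.added} {Z.added} {u} (X.spans i) (Z.spans i))
      rearrange : s ℕ.+ (t ℕ.+ g) ℕ.+ g ≡ (s ℕ.+ g) ℕ.+ (t ℕ.+ g)
      rearrange = ≡.trans (ℕₚ.+-assoc s (t ℕ.+ g) g)
        (≡.trans (≡.cong (s ℕ.+_) (ℕₚ.+-comm (t ℕ.+ g) g)) (≡.sym (ℕₚ.+-assoc s g (t ℕ.+ g))))

module SubsetProperties where

  open import Data.Nat using (_+_)
  open import Data.Nat.Properties using (+-suc)
  open import Data.Vec using ([]; _∷_; here; there)
  open import Data.Fin.Subset.Properties using (p─⊥≡p; nonempty?; x∈p⇒∣p-x∣<∣p∣; x∈p∩q⁺)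

  ∣p∪q∣+∣p∩q∣≡∣p∣+∣q∣ : ∀ {n} (p q : Subset n) → ∣ p ∪ q ∣ + ∣ p ∩ q ∣ ≡ ∣ p ∣ + ∣ q ∣
  ∣p∪q∣+∣p∩q∣≡∣p∣+∣q∣ []            []            = ≡.refl
  ∣p∪q∣+∣p∩q∣≡∣p∣+∣q∣ (inside  ∷ p) (inside  ∷ q) =
    ≡.cong suc (≡.trans (+-suc _ _) (≡.trans (≡.cong suc (∣p∪q∣+∣p∩q∣≡∣p∣+∣q∣ p q)) (≡.sym (+-suc _ _))))
  ∣p∪q∣+∣p∩q∣≡∣p∣+∣q∣ (inside  ∷ p) (outside ∷ q) = ≡.cong suc (∣p∪q∣+∣p∩q∣≡∣p∣+∣q∣ p q)
  ∣p∪q∣+∣p∩q∣≡∣p∣+∣q∣ (outside ∷ p) (inside  ∷ q) =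
    ≡.trans (≡.cong suc (∣p∪q∣+∣p∩q∣≡∣p∣+∣q∣ p q)) (≡.sym (+-suc _ _))
  ∣p∪q∣+∣p∩q∣≡∣p∣+∣q∣ (outside ∷ p) (outside ∷ q) = ∣p∪q∣+∣p∩q∣≡∣p∣+∣q∣ p q

  ∣p∣≡∣p∩q∣+∣p─q∣ : ∀ {n} (p q : Subset n) → ∣ p ∣ ≡ ∣ p ∩ q ∣ + ∣ p ─ q ∣
  ∣p∣≡∣p∩q∣+∣p─q∣ []            []            = ≡.refl
  ∣p∣≡∣p∩q∣+∣p─q∣ (inside  ∷ p) (inside  ∷ q) = ≡.cong suc (∣p∣≡∣p∩q∣+∣p─q∣ p q)
  ∣p∣≡∣p∩q∣+∣p─q∣ (inside  ∷ p) (outside ∷ q) =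
    ≡.trans (≡.cong suc (∣p∣≡∣p∩q∣+∣p─q∣ p q)) (≡.sym (+-suc _ _))
  ∣p∣≡∣p∩q∣+∣p─q∣ (outside ∷ p) (inside  ∷ q) = ∣p∣≡∣p∩q∣+∣p─q∣ p q
  ∣p∣≡∣p∩q∣+∣p─q∣ (outside ∷ p) (outside ∷ q) = ∣p∣≡∣p∩q∣+∣p─q∣ p q

  x∈p⇒∣p∣≡1+∣p-x∣ : ∀ {n} {x : Fin n} {p : Subset n} → x ∈ p → ∣ p ∣ ≡ suc ∣ p - x ∣
  x∈p⇒∣p∣≡1+∣p-x∣ {x = zero}  {inside  ∷ p} here        = ≡.cong (suc ∘ ∣_∣) (≡.sym (p─⊥≡p p))
  x∈p⇒∣p∣≡1+∣p-x∣ {x = suc x} {inside  ∷ p} (there x∈p) = ≡.cong suc (x∈p⇒∣p∣≡1+∣p-x∣ x∈p)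
  x∈p⇒∣p∣≡1+∣p-x∣ {x = suc x} {outside ∷ p} (there x∈p) = x∈p⇒∣p∣≡1+∣p-x∣ x∈p

  x∈p─q⇒x∉q : ∀ {n} {x : Fin n} (p q : Subset n) → x ∈ p ─ q → x ∉ q
  x∈p─q⇒x∉q (_ ∷ p) (inside  ∷ q) (there x∈p─q) (there x∈q) = x∈p─q⇒x∉q p q x∈p─q x∈q
  x∈p─q⇒x∉q (_ ∷ p) (outside ∷ q) (there x∈p─q) (there x∈q) = x∈p─q⇒x∉q p q x∈p─q x∈q

  ∪-least : ∀ {n} {p q r : Subset n} → p ⊆ r → q ⊆ r → p ∪ q ⊆ r
  ∪-least {p = p} {q} p⊆r q⊆r x∈p∪q = [ p⊆r , q⊆r ]′ (x∈p∪q⁻ p q x∈p∪q)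

  ∩-greatest : ∀ {n} {p q r : Subset n} → r ⊆ p → r ⊆ q → r ⊆ p ∩ q
  ∩-greatest r⊆p r⊆q x∈r = x∈p∩q⁺ (r⊆p x∈r , r⊆q x∈r)

  removal-induction : ∀ {n} (P : Subset n → Set ℓ₁) → (∀ {X} → Empty X → P X) →
    (∀ {X x} → x ∈ X → P (X - x) → P X) → ∀ X → P X
  removal-induction P empty remove X = go ∣ X ∣ X ≤-refl
    where
    go : ∀ k X → ∣ X ∣ ≤ k → P X
    go k X ∣X∣≤k with nonempty? X
    ... | no X-empty = empty X-empty
    go zero    X ∣X∣≤0   | yes (x , x∈X) = contradiction (<-≤-trans (x∈p⇒∣p-x∣<∣p∣ x∈X) ∣X∣≤0) n≮0
    go (suc k) X ∣X∣≤1+k | yes (x , x∈X) =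
      remove x∈X (go k (X - x) (s≤s⁻¹ (<-≤-trans (x∈p⇒∣p-x∣<∣p∣ x∈X) ∣X∣≤1+k)))

  ¬¬-∀-Subset : ∀ {n} {P : Subset n → Set ℓ₁} → (∀ S → DoubleNegation (P S)) → DoubleNegation (∀ S → P S)
  ¬¬-∀-Subset {n = zero}  h = ¬¬-map (λ P[] → λ { [] → P[] }) (h [])
  ¬¬-∀-Subset {n = suc n} h =
    ¬¬-∀-Subset (h ∘ (inside ∷_))  >>= λ P-inside →
    ¬¬-∀-Subset (h ∘ (outside ∷_)) >>= λ P-outside →
    pure λ { (inside ∷ S) → P-inside S ; (outside ∷ S) → P-outside S }

open SubsetProperties

module SubmodularMatroid {k} (f : Subset k → ℕ)
  (f-mono : ∀ {S T} → S ⊆ T → f S ≤ f T)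
  (f-submodular : ∀ S T → f (S ∪ T) ℕ.+ f (S ∩ T) ≤ f S ℕ.+ f T)
  (f-⊥ : f ⊥ ≡ 0)
  where

  open import Data.Nat using (_+_)
  open import Data.Nat.Properties using (+-mono-≤; +-monoˡ-≤; +-monoʳ-≤; +-cancelʳ-≤; module ≤-Reasoning)
  open import Data.Fin.Properties using () renaming (_≟_ to _≟ᶠ_)
  open ≤-Reasoning

  Independent : Subset k → Set
  Independent S = ∀ T → T ⊆ S → ∣ T ∣ ≤ f T

  Maximal : Subset k → Set
  Maximal B = ∀ j → j ∉ B → ¬ Independent (B ∪ ⁅ j ⁆)

  Tight : Subset k → Set
  Tight T = f T ≤ ∣ T ∣

  Spans : Subset k → Fin k → Set
  Spans T j = f (T ∪ ⁅ j ⁆) ≤ f T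

  Spans-mono : ∀ {Y Z j} → Y ⊆ Z → Spans Y j → Spans Z j
  Spans-mono {Y} {Z} {j} Y⊆Z Y-spans = +-cancelʳ-≤ (f Y) _ _ (begin
    f (Z ∪ ⁅ j ⁆) + f Y
      ≤⟨ +-mono-≤ (f-mono (∪-least (p⊆p∪q _) (q⊆p∪q Z _ ∘ q⊆p∪q Y _))) (f-mono (∩-greatest Y⊆Z (p⊆p∪q _))) ⟩
    f (Z ∪ (Y ∪ ⁅ j ⁆)) + f (Z ∩ (Y ∪ ⁅ j ⁆))
      ≤⟨ f-submodular Z (Y ∪ ⁅ j ⁆) ⟩
    f Z + f (Y ∪ ⁅ j ⁆)
      ≤⟨ +-monoʳ-≤ (f Z) Y-spans ⟩
    f Z + f Y
      ∎)

  Tight-∪ : ∀ {B U T} → Independent B → U ⊆ B → T ⊆ B → Tight U → Tight T → Tight (U ∪ T)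
  Tight-∪ {B} {U} {T} B-independent U⊆B T⊆B U-tight T-tight = +-cancelʳ-≤ (f (U ∩ T)) _ _ (begin
    f (U ∪ T) + f (U ∩ T)    ≤⟨ f-submodular U T ⟩
    f U + f T                ≤⟨ +-mono-≤ U-tight T-tight ⟩
    ∣ U ∣ + ∣ T ∣            ≡⟨ ∣p∪q∣+∣p∩q∣≡∣p∣+∣q∣ U T ⟨
    ∣ U ∪ T ∣ + ∣ U ∩ T ∣    ≤⟨ +-monoʳ-≤ ∣ U ∪ T ∣ (B-independent (U ∩ T) (U⊆B ∘ p∩q⊆p U T)) ⟩
    ∣ U ∪ T ∣ + f (U ∩ T)    ∎)

  ¬Independent⇒violator : ∀ {S} → ¬ Independent S → ∃ λ T → T ⊆ S × f T < ∣ T ∣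
  ¬Independent⇒violator {S} ¬independent with anySubset? (λ T → (T ⊆? S) ×-dec (f T <? ∣ T ∣))
  ... | yes violator = violator
  ... | no  none     = contradiction (λ T T⊆S → ≮⇒≥ λ fT<∣T∣ → none (T , (λ {x} → T⊆S {x}) , fT<∣T∣)) ¬independent

  TightlySpanned : Subset k → Fin k → Set
  TightlySpanned B j = ∃ λ T → T ⊆ B × Tight T × Spans T j

  TightSpanner : Subset k → Subset k → Set
  TightSpanner B X = ∃ λ U → U ⊆ B × Tight U × ∀ {j} → j ∈ X → Spans U j

  dependent-extension⇒TightlySpanned : ∀ {B j} → Independent B → ¬ Independent (B ∪ ⁅ j ⁆) → TightlySpanned B j
  dependent-extension⇒TightlySpanned {B} {j} B-independent ¬independent with ¬Independent⇒violator ¬independent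
  ... | T , T⊆B∪j , fT<∣T∣ with j ∈? T
  ...   | no j∉T  = contradiction (B-independent T T⊆B) (<⇒≱ fT<∣T∣)
    where
    T⊆B : T ⊆ B
    T⊆B x∈T = [ id , (λ x∈⁅j⁆ → contradiction (≡.subst (_∈ T) (x∈⁅y⁆⇒x≡y j x∈⁅j⁆) x∈T) j∉T) ]′
                (x∈p∪q⁻ B ⁅ j ⁆ (T⊆B∪j x∈T))
  ...   | yes j∈T = T - j , T-j⊆B , ≤-trans (f-mono (p─q⊆p T ⁅ j ⁆)) fT≤∣T-j∣ , spans
    where
    fT≤∣T-j∣ : f T ≤ ∣ T - j ∣
    fT≤∣T-j∣ = s≤s⁻¹ (≡.subst (f T <_) (x∈p⇒∣p∣≡1+∣p-x∣ j∈T) fT<∣T∣)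
    T-j⊆B : T - j ⊆ B
    T-j⊆B x∈T-j = [ id , (λ x∈⁅j⁆ → contradiction x∈⁅j⁆ (x∈p─q⇒x∉q T ⁅ j ⁆ x∈T-j)) ]′
                    (x∈p∪q⁻ B ⁅ j ⁆ (T⊆B∪j (p─q⊆p T ⁅ j ⁆ x∈T-j)))
    ⁅j⁆⊆T : ⁅ j ⁆ ⊆ T
    ⁅j⁆⊆T x∈⁅j⁆ = ≡.subst (_∈ T) (≡.sym (x∈⁅y⁆⇒x≡y j x∈⁅j⁆)) j∈T
    spans : Spans (T - j) j
    spans = begin
      f ((T - j) ∪ ⁅ j ⁆)  ≤⟨ f-mono (∪-least (p─q⊆p T ⁅ j ⁆) ⁅j⁆⊆T) ⟩
      f T                ≤⟨ fT≤∣T-j∣ ⟩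
      ∣ T - j ∣          ≤⟨ B-independent (T - j) T-j⊆B ⟩
      f (T - j)          ∎

  Spans-all : ∀ {Z} X → (∀ {i} → i ∈ X → Spans Z i) → f (Z ∪ X) ≤ f Z
  Spans-all {Z} = removal-induction P empty remove
    where
    P : Subset k → Set
    P X = (∀ {i} → i ∈ X → Spans Z i) → f (Z ∪ X) ≤ f Z
    empty : ∀ {X} → Empty X → P X
    empty X-empty _ = f-mono (∪-least ⊆-refl λ x∈X → contradiction (_ , x∈X) X-empty)
    remove : ∀ {X x} → x ∈ X → P (X - x) → P X
    remove {X} {x} x∈X ih X-spanned = begin
      f (Z ∪ X)                  ≤⟨ f-mono (∪-least (λ z → p⊆p∪q _ (p⊆p∪q _ z)) X⊆) ⟩
      f ((Z ∪ (X - x)) ∪ ⁅ x ⁆)  ≤⟨ Spans-mono (p⊆p∪q (X - x)) (X-spanned x∈X) ⟩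
      f (Z ∪ (X - x))            ≤⟨ ih (X-spanned ∘ p─q⊆p X ⁅ x ⁆) ⟩
      f Z                        ∎
      where
      X⊆ : X ⊆ (Z ∪ (X - x)) ∪ ⁅ x ⁆
      X⊆ {y} y∈X with y ≟ᶠ x
      ... | yes ≡.refl = q⊆p∪q _ _ (x∈⁅x⁆ x)
      ... | no  y≢x    = p⊆p∪q _ (q⊆p∪q Z _ (x∈p∧x≢y⇒x∈p-y y∈X y≢x))

  collect-TightSpanner : ∀ {B} → Independent B → ∀ X → (∀ {j} → j ∈ X → TightlySpanned B j) → TightSpanner B X
  collect-TightSpanner {B} B-independent = removal-induction P empty remove
    where
    P : Subset k → Set
    P X = (∀ {j} → j ∈ X → TightlySpanned B j) → TightSpanner B X
    empty : ∀ {X} → Empty X → P X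
    empty X-empty _ =
      ⊥ , ⊥⊆ , ≡.subst (_≤ ∣ ⊥ {k} ∣) (≡.sym f-⊥) z≤n , λ j∈X → contradiction (_ , j∈X) X-empty
    remove : ∀ {X x} → x ∈ X → P (X - x) → P X
    remove {X} {x} x∈X ih X-spanned with ih (X-spanned ∘ p─q⊆p X ⁅ x ⁆) | X-spanned x∈X
    ... | U , U⊆B , U-tight , U-spans | T , T⊆B , T-tight , T-spans =
      U ∪ T , ∪-least U⊆B T⊆B , Tight-∪ B-independent U⊆B T⊆B U-tight T-tight , spans
      where
      spans : ∀ {j} → j ∈ X → Spans (U ∪ T) j
      spans {j} j∈X with j ≟ᶠ x
      ... | yes ≡.refl = Spans-mono (q⊆p∪q U T) T-spans
      ... | no  j≢x    = Spans-mono (p⊆p∪q T) (U-spans (x∈p∧x≢y⇒x∈p-y j∈X j≢x))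

  Maximal⇒TightlySpanned : ∀ {B j} → Independent B → Maximal B → j ∉ B → TightlySpanned B j
  Maximal⇒TightlySpanned B-independent B-maximal j∉B =
    dependent-extension⇒TightlySpanned B-independent (B-maximal _ j∉B)

  ∣Independent∣≤∣Maximal∣ : ∀ {B S} → Independent B → Maximal B → Independent S → ∣ S ∣ ≤ ∣ B ∣
  ∣Independent∣≤∣Maximal∣ {B} {S} B-independent B-maximal S-independent
    with collect-TightSpanner B-independent (∁ B) (Maximal⇒TightlySpanned B-independent B-maximal ∘ x∈∁p⇒x∉p)
  ... | U , U⊆B , U-tight , U-spans = begin
    ∣ S ∣                    ≡⟨ ∣p∣≡∣p∩q∣+∣p─q∣ S D ⟩
    ∣ S ∩ D ∣ + ∣ S ─ D ∣    ≤⟨ +-mono-≤ ∣S∩D∣≤∣U∣ (p⊆q⇒∣p∣≤∣q∣ S─D⊆B─U) ⟩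
    ∣ U ∣ + ∣ B ─ U ∣        ≤⟨ +-monoˡ-≤ ∣ B ─ U ∣ (p⊆q⇒∣p∣≤∣q∣ (∩-greatest U⊆B ⊆-refl)) ⟩
    ∣ B ∩ U ∣ + ∣ B ─ U ∣    ≡⟨ ∣p∣≡∣p∩q∣+∣p─q∣ B U ⟨
    ∣ B ∣                    ∎
    where
    D = U ∪ ∁ B
    ∣S∩D∣≤∣U∣ : ∣ S ∩ D ∣ ≤ ∣ U ∣
    ∣S∩D∣≤∣U∣ = begin
      ∣ S ∩ D ∣    ≤⟨ S-independent (S ∩ D) (p∩q⊆p S D) ⟩
      f (S ∩ D)    ≤⟨ f-mono (p∩q⊆q S D) ⟩
      f D          ≤⟨ Spans-all (∁ B) U-spans ⟩
      f U          ≤⟨ U-tight ⟩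
      ∣ U ∣        ∎
    S─D⊆B─U : S ─ D ⊆ B ─ U
    S─D⊆B─U x∈S─D = x∈p∧x∉q⇒x∈p─q (x∉∁p⇒x∈p (x∉D ∘ q⊆p∪q U _)) (x∉D ∘ p⊆p∪q _)
      where x∉D = x∈p─q⇒x∉q S D x∈S─D

  f⊤≤f-Maximal : ∀ {B} → Independent B → Maximal B → f ⊤ ≤ f B
  f⊤≤f-Maximal {B} B-independent B-maximal = begin
    f ⊤          ≤⟨ f-mono (⊆-reflexive (≡.sym (p∪∁p≡⊤ B))) ⟩
    f (B ∪ ∁ B)  ≤⟨ Spans-all (∁ B) B-spans ⟩
    f B          ∎
    where
    B-spans : ∀ {j} → j ∈ ∁ B → Spans B j
    B-spans j∈∁B with Maximal⇒TightlySpanned B-independent B-maximal (x∈∁p⇒x∉p j∈∁B)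
    ... | T , T⊆B , _ , T-spans = Spans-mono T⊆B T-spans

module Minkowski {c ℓ} (K : Field c ℓ) (m : ℕ) where

  open import Data.Vec using ([]; _∷_; here)
  open import Data.Fin.Subset.Properties using (drop-∷-⊆)
  open import Data.Nat.Properties using (module ≤-Reasoning)
  open Field K using (Carrier; _≈_; _+_; 0#; 1#; 1≉0; refl; sym; trans; +-congˡ; +-congʳ; *-congˡ;
                      +-assoc; +-comm; +-identityˡ; zeroʳ; +-commutativeMonoid)
  open import Algebra.Properties.CommutativeMonoid.Sum +-commutativeMonoid using (sum)
  open LinAlg K m
  module C = Coordinates K

  Σᵥ-coordinate : ∀ {k} (f : Fin k → V) j → Σᵥ f j ≡ sum (λ i → f i j)
  Σᵥ-coordinate {zero}  f j = ≡.refl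
  Σᵥ-coordinate {suc k} f j = ≡.cong (f zero j +_) (Σᵥ-coordinate (f ∘ suc) j)

  LinIndepVecs⇔Independent : ∀ {k} {v : Fin k → V} → LinIndepVecs v ⇔ C.Independent v
  LinIndepVecs⇔Independent {v = v} = mk⇔
    (λ independent a a·v≈0 → independent a λ j → ≡.subst (_≈ 0#) (≡.sym (Σᵥ-coordinate (a ·ᵢ v) j)) (a·v≈0 j))
    (λ independent a a·v≈0 → independent a λ j → ≡.subst (_≈ 0#) (Σᵥ-coordinate (a ·ᵢ v) j) (a·v≈0 j))
    where
    _·ᵢ_ : (Fin _ → Carrier) → (Fin _ → V) → Fin _ → V
    (a ·ᵢ v) i = a i · v i

  DimGE⇔DimAtLeast : ∀ {P : V → Set (c ⊔ ℓ)} {k} → DimGE P k ⇔ C.DimAtLeast P k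
  DimGE⇔DimAtLeast = mk⇔
    (λ (v , v∈P , independent) → v , v∈P , to (LinIndepVecs⇔Independent {v = v}) independent)
    (λ (v , v∈P , independent) → v , v∈P , from (LinIndepVecs⇔Independent {v = v}) independent)

  DimGE-mono : ∀ {P Q : V → Set (c ⊔ ℓ)} {k} → (∀ {v} → P v → Q v) → DimGE P k → DimGE Q k
  DimGE-mono P⊆Q (v , v∈P , independent) = v , P⊆Q ∘ v∈P , independent

  ¬DimGE⇒≤ : ∀ {P : V → Set (c ⊔ ℓ)} {d k} → ¬ DimGE P (suc d) → DimGE P k → k ≤ d
  ¬DimGE⇒≤ {P} ¬dim dim =
    C.dim-bound {P = P} (¬dim ∘ from (DimGE⇔DimAtLeast {P})) (to (DimGE⇔DimAtLeast {P}) dim)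

  HasDim⇒≤ : ∀ {P : V → Set (c ⊔ ℓ)} {d k} → HasDim P d → DimGE P k → k ≤ d
  HasDim⇒≤ {P} (_ , ¬dim) = ¬DimGE⇒≤ {P} ¬dim

  HasDim⇒DimGE : ∀ {P : V → Set (c ⊔ ℓ)} {d k} → HasDim P d → k ≤ d → DimGE P k
  HasDim⇒DimGE {P} (dim , _) k≤d =
    from (DimGE⇔DimAtLeast {P}) (C.DimAtLeast-≤ {P = P} k≤d (to (DimGE⇔DimAtLeast {P}) dim))

  HasDim-unique : ∀ {P : V → Set (c ⊔ ℓ)} {d e} → HasDim P d → HasDim P e → d ≡ e
  HasDim-unique {P} d-dim e-dim =
    ≤-antisym (HasDim⇒≤ {P} e-dim (proj₁ d-dim)) (HasDim⇒≤ {P} d-dim (proj₁ e-dim))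

  ¬¬-HasDim : (P : V → Set (c ⊔ ℓ)) → DoubleNegation (∃ (HasDim P))
  ¬¬-HasDim P = search m λ (v , _ , independent) →
    1+n≰n (C.independent⇒≤ {v = v} (to (LinIndepVecs⇔Independent {v = v}) independent))
    where
    search : ∀ d → ¬ DimGE P (suc d) → DoubleNegation (∃ (HasDim P))
    search zero    ¬dim = pure (0 , ((λ ()) , (λ ()) , λ _ _ ()) , ¬dim)
    search (suc d) ¬dim = ¬¬-excluded-middle >>= λ
      { (yes dim)  → pure (suc d , dim , ¬dim)
      ; (no ¬dim′) → search d ¬dim′ }

  ¬DimGE-zero : ∀ {P : V → Set (c ⊔ ℓ)} → (∀ {v} → P v → v ≈ᵥ 0ᵥ) → ¬ DimGE P 1
  ¬DimGE-zero P≈0 (v , v∈P , independent) = 1≉0 (independent (const 1#) 1·v≈0 zero)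
    where
    1·v≈0 : (1# · v zero) +ᵥ 0ᵥ ≈ᵥ 0ᵥ
    1·v≈0 j = trans (+-congʳ (trans (*-congˡ (P≈0 (v∈P zero) j)) (zeroʳ 1#))) (+-identityˡ 0#)

  mask : ∀ {k} → Subset k → (Fin k → V) → Fin k → V
  mask (inside  ∷ S) w zero    = w zero
  mask (inside  ∷ S) w (suc i) = mask S (w ∘ suc) i
  mask (outside ∷ S) w zero    = 0ᵥ
  mask (outside ∷ S) w (suc i) = mask S (w ∘ suc) i

  mask-Mem : ∀ {k} (n : Tuple k) S {w} → (∀ i → Mem (n i) (w i)) → ∀ i → Mem (n i) (mask S w i)
  mask-Mem n (inside  ∷ S) w∈n zero    = w∈n zero
  mask-Mem n (inside  ∷ S) w∈n (suc i) = mask-Mem (n ∘ suc) S (w∈n ∘ suc) i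
  mask-Mem n (outside ∷ S) w∈n zero    = has0 (n zero)
  mask-Mem n (outside ∷ S) w∈n (suc i) = mask-Mem (n ∘ suc) S (w∈n ∘ suc) i

  Σᵥ[⊆]-mask : ∀ {k} {S T : Subset k} → S ⊆ T → ∀ w → Σᵥ[ T ] (mask S w) ≈ᵥ Σᵥ[ S ] w
  Σᵥ[⊆]-mask {S = []}          {[]}          _   w j = refl
  Σᵥ[⊆]-mask {S = inside  ∷ S} {inside  ∷ T} S⊆T w j = +-congˡ (Σᵥ[⊆]-mask (drop-∷-⊆ S⊆T) (w ∘ suc) j)
  Σᵥ[⊆]-mask {S = inside  ∷ S} {outside ∷ T} S⊆T w j with () ← S⊆T here
  Σᵥ[⊆]-mask {S = outside ∷ S} {inside  ∷ T} S⊆T w j =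
    trans (+-identityˡ _) (Σᵥ[⊆]-mask (drop-∷-⊆ S⊆T) (w ∘ suc) j)
  Σᵥ[⊆]-mask {S = outside ∷ S} {outside ∷ T} S⊆T w j = Σᵥ[⊆]-mask (drop-∷-⊆ S⊆T) (w ∘ suc) j

  Σᵥ[∪] : ∀ {k} (S T : Subset k) w → Σᵥ[ S ∪ T ] w ≈ᵥ Σᵥ[ S ] w +ᵥ Σᵥ[ T ] (mask (∁ S) w)
  Σᵥ[∪] []            []            w j = sym (+-identityˡ 0#)
  Σᵥ[∪] (inside  ∷ S) (inside  ∷ T) w j =
    trans (+-congˡ (Σᵥ[∪] S T (w ∘ suc) j)) (trans (sym (+-assoc _ _ _)) (+-congˡ (sym (+-identityˡ _))))
  Σᵥ[∪] (inside  ∷ S) (outside ∷ T) w j = trans (+-congˡ (Σᵥ[∪] S T (w ∘ suc) j)) (sym (+-assoc _ _ _))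
  Σᵥ[∪] (outside ∷ S) (inside  ∷ T) w j =
    trans (+-congˡ (Σᵥ[∪] S T (w ∘ suc) j))
          (trans (sym (+-assoc _ _ _)) (trans (+-congʳ (+-comm _ _)) (+-assoc _ _ _)))
  Σᵥ[∪] (outside ∷ S) (outside ∷ T) w j = Σᵥ[∪] S T (w ∘ suc) j

  Σᵥ[⊥] : ∀ {k} w → Σᵥ[ ⊥ {k} ] w ≈ᵥ 0ᵥ
  Σᵥ[⊥] {zero}  w j = refl
  Σᵥ[⊥] {suc k} w j = Σᵥ[⊥] (w ∘ suc) j

  module _ {k} (n : Tuple k) where

    ⟨∣⟩-mono : ∀ {S T} → S ⊆ T → ∀ {v} → ⟨ n ∣ S ⟩ v → ⟨ n ∣ T ⟩ v
    ⟨∣⟩-mono {S} S⊆T (w , w∈n , v≈Σw) =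
      mask S w , mask-Mem n S w∈n , λ j → trans (v≈Σw j) (sym (Σᵥ[⊆]-mask S⊆T w j))

    ⟨∣⟩-∪ : ∀ {S T v} → ⟨ n ∣ S ∪ T ⟩ v → Σ V λ x → Σ V λ z → ⟨ n ∣ S ⟩ x × ⟨ n ∣ T ⟩ z × ∀ j → v j ≈ x j + z j
    ⟨∣⟩-∪ {S} {T} (w , w∈n , v≈Σw) =
      Σᵥ[ S ] w , Σᵥ[ T ] (mask (∁ S) w) , (w , w∈n , λ _ → refl) ,
      (mask (∁ S) w , mask-Mem n (∁ S) w∈n , λ _ → refl) , λ j → trans (v≈Σw j) (Σᵥ[∪] S T w j)

    ⟨∣⊥⟩≈0 : ∀ {v} → ⟨ n ∣ ⊥ ⟩ v → v ≈ᵥ 0ᵥ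
    ⟨∣⊥⟩≈0 (w , _ , v≈Σw) j = trans (v≈Σw j) (Σᵥ[⊥] w j)

    DimGE-⟨∣⟩-mono : ∀ {S T d} → S ⊆ T → DimGE ⟨ n ∣ S ⟩ d → DimGE ⟨ n ∣ T ⟩ d
    DimGE-⟨∣⟩-mono {S} {T} S⊆T = DimGE-mono {⟨ n ∣ S ⟩} {⟨ n ∣ T ⟩} (⟨∣⟩-mono S⊆T)

    module Dimensions (dim : Subset k → ℕ) (hasDim : ∀ S → HasDim ⟨ n ∣ S ⟩ (dim S)) where

      dim-mono : ∀ {S T} → S ⊆ T → dim S ≤ dim T
      dim-mono {S} {T} S⊆T = HasDim⇒≤ {⟨ n ∣ T ⟩} (hasDim T) (DimGE-⟨∣⟩-mono S⊆T (proj₁ (hasDim S)))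

      dim-∪+dim-∩ : ∀ S T → dim (S ∪ T) ℕ.+ dim (S ∩ T) ≤ dim S ℕ.+ dim T
      dim-∪+dim-∩ S T = C.dim-submodular
        (λ v∈S∩T → ⟨∣⟩-mono (p∩q⊆p S T) v∈S∩T , ⟨∣⟩-mono (p∩q⊆q S T) v∈S∩T) ⟨∣⟩-∪
        (proj₂ (hasDim S) ∘ from (DimGE⇔DimAtLeast {⟨ n ∣ S ⟩}))
        (proj₂ (hasDim T) ∘ from (DimGE⇔DimAtLeast {⟨ n ∣ T ⟩}))
        (to (DimGE⇔DimAtLeast {⟨ n ∣ S ∪ T ⟩}) (proj₁ (hasDim (S ∪ T))))
        (to (DimGE⇔DimAtLeast {⟨ n ∣ S ∩ T ⟩}) (proj₁ (hasDim (S ∩ T))))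

      dim-⊥ : dim ⊥ ≡ 0
      dim-⊥ = n≤0⇒n≡0 (¬DimGE⇒≤ {⟨ n ∣ ⊥ ⟩} (¬DimGE-zero {⟨ n ∣ ⊥ ⟩} ⟨∣⊥⟩≈0) (proj₁ (hasDim ⊥)))

      open SubmodularMatroid dim dim-mono dim-∪+dim-∩ dim-⊥ public

      IsLinIndep⇔Independent : ∀ {S} → IsLinIndep n S ⇔ Independent S
      IsLinIndep⇔Independent = mk⇔
        (λ S-independent T T⊆S → HasDim⇒≤ {⟨ n ∣ T ⟩} (hasDim T) (S-independent T T⊆S))
        (λ S-independent T T⊆S → HasDim⇒DimGE {⟨ n ∣ T ⟩} (hasDim T) (S-independent T T⊆S))

      IsBasis⇒Maximal : ∀ {B} → IsBasis n B → Maximal B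
      IsBasis⇒Maximal {B} (_ , B-maximal) j j∉B B∪j-independent = j∉B
        (B-maximal (B ∪ ⁅ j ⁆) (p⊆p∪q _) (from IsLinIndep⇔Independent B∪j-independent) (q⊆p∪q B _ (x∈⁅x⁆ j)))

    ¬¬-dimensions : DoubleNegation (∀ S → ∃ λ d → HasDim ⟨ n ∣ S ⟩ d)
    ¬¬-dimensions = ¬¬-∀-Subset λ S → ¬¬-HasDim ⟨ n ∣ S ⟩

    IsBasis⇒∣∣≡rank : ∀ {r B} → HasRank n r → IsBasis n B → ∣ B ∣ ≡ r
    IsBasis⇒∣∣≡rank {r} {B} ((S , S-independent , ∣S∣≡r) , rank-max) B-basis@(B-independent , _) =
      ≤-antisym (rank-max B B-independent) (decidable-stable (r ≤? ∣ B ∣) (¬¬-map r≤∣B∣ ¬¬-dimensions))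
      where
      r≤∣B∣ : (∀ S → ∃ λ d → HasDim ⟨ n ∣ S ⟩ d) → r ≤ ∣ B ∣
      r≤∣B∣ dims = ≡.subst (_≤ ∣ B ∣) ∣S∣≡r
        (∣Independent∣≤∣Maximal∣ (to IsLinIndep⇔Independent B-independent) (IsBasis⇒Maximal B-basis)
                                 (to IsLinIndep⇔Independent S-independent))
        where open Dimensions (proj₁ ∘ dims) (proj₂ ∘ dims)

    IsBasis⇒HasDim : ∀ {B e} → IsBasis n B → HasDim ⟨ n ∣ B ⟩ e → HasDim ⟨ n ⟩ e
    IsBasis⇒HasDim {B} {e} B-basis@(B-independent , _) (B-dim , ¬B-dim) =
      DimGE-⟨∣⟩-mono ⊆⊤ B-dim , λ ⊤-dim → ¬¬-dimensions λ dims → ¬B-dim (B-dim≥⊤-dim dims ⊤-dim)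
      where
      B-dim≥⊤-dim : (∀ S → ∃ λ d → HasDim ⟨ n ∣ S ⟩ d) → DimGE ⟨ n ⟩ (suc e) → DimGE ⟨ n ∣ B ⟩ (suc e)
      B-dim≥⊤-dim dims ⊤-dim = HasDim⇒DimGE {⟨ n ∣ B ⟩} (proj₂ (dims B)) (begin
        suc e  ≤⟨ HasDim⇒≤ {⟨ n ⟩} (proj₂ (dims ⊤)) ⊤-dim ⟩
        dim ⊤  ≤⟨ f⊤≤f-Maximal (to IsLinIndep⇔Independent B-independent) (IsBasis⇒Maximal B-basis) ⟩
        dim B  ∎)
        where
        dim = proj₁ ∘ dims
        open Dimensions dim (proj₂ ∘ dims)
        open ≤-Reasoning

    max-card⇒IsBasis : ∀ {S} → IsLinIndep n S → (∀ T → IsLinIndep n T → ∣ T ∣ ≤ ∣ S ∣) → IsBasis n S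
    max-card⇒IsBasis {S} S-independent S-max = S-independent , T⊆S
      where
      T⊆S : ∀ T → S ⊆ T → IsLinIndep n T → T ⊆ S
      T⊆S T S⊆T T-independent {x} x∈T with x ∈? S
      ... | yes x∈S = x∈S
      ... | no  x∉S =
        contradiction (S-max T T-independent) (<⇒≱ (p⊂q⇒∣p∣<∣q∣ ((λ {y} → S⊆T {y}) , x , x∈T , x∉S)))

corollary1p26 : ∀ {c ℓ : Level} (K : Field c ℓ) (m k : ℕ) (n : LinAlg.Tuple K m k) →
    LinAlg.IsLinDep K m n →
    ∀ (r d : ℕ) → LinAlg.HasRank K m n r → LinAlg.HasDim K m (LinAlg.⟨_⟩ K m n) d →
    (r ≡ d) ⇔ (∀ (B : Subset k) → LinAlg.IsBasis K m n B → LinAlg.IsBK K m n B)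
corollary1p26 K m k n _ r d rank@((S , S-independent , ∣S∣≡r) , rank-max) ⟨n⟩-dim = mk⇔ bases-BK r≡d
  where
  open LinAlg K m
  open Minkowski K m

  bases-BK : r ≡ d → ∀ B → IsBasis n B → IsBK n B
  bases-BK r≡d B B-basis@(B-independent , _) = B-independent , B-independent B ⊆-refl , λ B-dim →
    proj₂ ⟨n⟩-dim (≡.subst (DimGE ⟨ n ⟩ ∘ suc) (≡.trans (IsBasis⇒∣∣≡rank n rank B-basis) r≡d)
                           (DimGE-⟨∣⟩-mono n ⊆⊤ B-dim))

  r≡d : (∀ B → IsBasis n B → IsBK n B) → r ≡ d
  r≡d all-BK =
    ≡.trans (≡.sym ∣S∣≡r) (HasDim-unique {⟨ n ⟩} (IsBasis⇒HasDim n S-basis (proj₂ (all-BK S S-basis))) ⟨n⟩-dim)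
    where
    S-basis : IsBasis n S
    S-basis = max-card⇒IsBasis n S-independent λ T T-independent →
      ≡.subst (∣ T ∣ ≤_) (≡.sym ∣S∣≡r) (rank-max T T-independent)
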